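{- Let $G=(V,E)$ be a graph (all edges of unit weight), let $\chi$ be a $c$-coloring of $G$, and let $k$ be an integer. Let $v\in V$ be a vertex which is $(i,k)$-blocked in $G$ with respect to $\chi$, for some color $i\in[1,c]\setminus\{\chi(v)\}$. Then there is no inclusion-minimal improving $k$-neighbor $\chi'$ of $\chi$ with $\chi'(v)=i$.
   Context: A $c$-coloring of $G=(V,E)$ is a function $\chi:V\to[1,c]=\{1,\dots,c\}$. For colorings $\chi,\chi'$, $D_{\mathrm{flip}}(\chi,\chi')=\{x\in V:\chi(x)\neq\chi'(x)\}$ and $d_{\mathrm{flip}}(\chi,\chi')=|D_{\mathrm{flip}}(\chi,\chi')|$. $E(\chi)=\{\{u,v\}\in E:\chi(u)\neq\chi(v)\}$ is the set of properly colored edges. $\chi'$ is a $k$-neighbor of $\chi$ if $d_{\mathrm{flip}}(\chi,\chi')\le k$; it is improving over $\chi$ if $|E(\chi')|>|E(\chi)|$ (unit weights). $\chi'$ is an inclusion-minimal improving $k$-neighbor (k-flip) of $\chi$ if it is an improving $k$-neighbor of $\chi$ and there is no improving $k$-neighbor $\tilde\chi$ of $\chi$ with $D_{\mathrm{flip}}(\chi,\tilde\chi)\subsetneq D_{\mathrm{flip}}(\chi,\chi')$. For $i\neq\chi(v)$, the vertex $v$ is $(i,k)$-blocked in $G$ with respect to $\chi$ if $|\{w\in N(v):\chi(w)=i\}|\ge|\{w\in N(v):\chi(w)=\chi(v)\}|+2k-1$. -}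

module Defs where

open import Data.Bool using (Bool; true; false; _∧_; not)
open import Data.Nat using (ℕ; zero; suc)
open import Data.Fin using (Fin; _<?_)
open import Data.Fin.Properties using (_≟_)
open import Data.List using (List; []; _∷_; allFin; cartesianProduct)
open import Data.Product using (_×_; _,_; Σ; ∃)
open import Data.Integer using (ℤ; +_; _-_; _≤_; _+_; _*_)
open import Relation.Binary.PropositionalEquality using (_≡_)
open import Relation.Nullary using (¬_; does)

record Graph : Set where
  field
    n      : ℕ
    adj    : Fin n → Fin n → Bool
    sym    : ∀ u v → adj u v ≡ adj v u
    irrefl : ∀ v → adj v v ≡ false
open Graph public

-- A c-coloring; colors [1,c] are represented by Fin c.
Coloring : Graph → ℕ → Set
Coloring G c = Fin (n G) → Fin c

countB : {A : Set} → (A → Bool) → List A → ℕ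
countB p [] = zero
countB p (x ∷ xs) with p x
... | true  = suc (countB p xs)
... | false = countB p xs

InDflip : (G : Graph) {c : ℕ} → Coloring G c → Coloring G c → Fin (n G) → Set
InDflip G χ χ' x = ¬ (χ x ≡ χ' x)

dflip : (G : Graph) {c : ℕ} → Coloring G c → Coloring G c → ℕ
dflip G χ χ' = countB (λ x → not (does (χ x ≟ χ' x))) (allFin (n G))

numProper : (G : Graph) {c : ℕ} → Coloring G c → ℕ
numProper G χ =
  countB (λ { (u , v) → does (u <? v) ∧ adj G u v ∧ not (does (χ u ≟ χ v)) })
         (cartesianProduct (allFin (n G)) (allFin (n G)))

IsKNeighbor : (G : Graph) {c : ℕ} → ℤ → Coloring G c → Coloring G c → Set
IsKNeighbor G k χ χ' = + dflip G χ χ' ≤ k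

Improving : (G : Graph) {c : ℕ} → Coloring G c → Coloring G c → Set
Improving G χ χ' = numProper G χ Data.Nat.< numProper G χ'

IsImprovingKNeighbor : (G : Graph) {c : ℕ} → ℤ → Coloring G c → Coloring G c → Set
IsImprovingKNeighbor G k χ χ' = IsKNeighbor G k χ χ' × Improving G χ χ'

DflipStrictSubset : (G : Graph) {c : ℕ} → Coloring G c → Coloring G c → Coloring G c → Set
DflipStrictSubset G χ χ̃ χ' =
  (∀ x → InDflip G χ χ̃ x → InDflip G χ χ' x) ×
  Σ (Fin (n G)) (λ x → InDflip G χ χ' x × ¬ InDflip G χ χ̃ x)

IsMinimalImprovingKNeighbor : (G : Graph) {c : ℕ} → ℤ → Coloring G c → Coloring G c → Set
IsMinimalImprovingKNeighbor G k χ χ' =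
  IsImprovingKNeighbor G k χ χ' ×
  (∀ χ̃ → ¬ (IsImprovingKNeighbor G k χ χ̃ × DflipStrictSubset G χ χ̃ χ'))

nbrsWithColor : (G : Graph) {c : ℕ} → Coloring G c → Fin (n G) → Fin c → ℕ
nbrsWithColor G χ v i = countB (λ w → adj G v w ∧ does (χ w ≟ i)) (allFin (n G))

-- v is (i,k)-blocked in G w.r.t. χ (assumes i ≠ χ(v), stated separately)
Blocked : (G : Graph) {c : ℕ} → Coloring G c → Fin (n G) → Fin c → ℤ → Set
Blocked G χ v i k =
  + nbrsWithColor G χ v i ≥ + nbrsWithColor G χ v (χ v) + (+ 2 * k - + 1)
  where open Data.Integer using (_≥_)

-- Let χ̃ be χ' with the colour of v reverted to χ(v). Its flip set is D_flip(χ,χ') ∖ {v}, so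
-- minimality of χ' forces χ̃ to be non-improving; we show it is improving. The number of
-- properly coloured edges plus the number of neighbours of v sharing v's colour depends only
-- on the colours off v, so |E(χ')| + N'_i = |E(χ̃)| + Ñ_{χ(v)}. With d = d_flip(χ,χ') ≤ k,
-- colour classes around v move by at most d resp. d − 1 between χ, χ' and χ̃, so
-- N'_i ≥ N_i − d and Ñ_{χ(v)} ≤ N_{χ(v)} + d − 1, and blocking (N_i ≥ N_{χ(v)} + 2k − 1)
-- yields |E(χ̃)| ≥ |E(χ')| > |E(χ)|.
module Submission where

open import Defs hiding (sym)
open import Data.Nat using (ℕ)
open import Data.Fin using (Fin)
open import Data.Integer using (ℤ)
open import Data.Product using (_×_)
open import Relation.Binary.PropositionalEquality using (_≡_)
open import Relation.Nullary using (¬_)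

import Data.Integer as ℤ
import Data.Integer.Properties as ℤₚ
import Data.Nat.Properties
open import Algebra.Properties.CommutativeMonoid.Sum Data.Nat.Properties.+-0-commutativeMonoid
  using (sum; sum-syntax; sum-cong-≗; sum-replicate-zero; ∑-distrib-+; ∑-comm)
open import Data.Bool using (Bool; true; false; _∧_; not)
open import Data.Empty using (⊥-elim)
open import Data.Fin using (_<?_)
open import Data.Fin.Properties using (_≟_; <-irrefl; <-cmp; <-asym)
open import Data.List using (List; []; _∷_; _++_; map; tabulate; allFin; cartesianProduct)
open import Data.Nat using (zero; suc; _+_; _*_; _≤_; z≤n; s≤s)
open import Data.Nat.Properties
  using ( +-assoc; +-suc; +-identityʳ; *-identityˡ; *-identityʳ; *-distribʳ-+
        ; ≤-refl; ≤-trans; ≤-pred; <-≤-trans; m≤m+n; m≤n+m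
        ; +-mono-≤; +-monoˡ-≤; +-monoʳ-≤; +-cancelʳ-≤; module ≤-Reasoning )
open import Data.Nat.Tactic.RingSolver using (solve-∀)
open import Data.Product using (_,_)
open import Data.Vec.Functional using (updateAt)
open import Data.Vec.Functional.Properties using (updateAt-updates; updateAt-minimal)
open import Function using (_∘_; id; const)
open import Relation.Binary.Definitions using (tri<; tri≈; tri>)
open import Relation.Binary.PropositionalEquality using (_≢_; refl; sym; trans; cong; cong₂; subst; module ≡-Reasoning)
open import Relation.Nullary using (does; yes; no)
open import Relation.Nullary.Decidable using (dec-true; dec-false)

⟦_⟧ : Bool → ℕ
⟦ true ⟧  = 1
⟦ false ⟧ = 0

⟦⟧≤1 : ∀ b → ⟦ b ⟧ ≤ 1
⟦⟧≤1 true  = ≤-refl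
⟦⟧≤1 false = z≤n

⟦∧not⟧+⟦∧⟧ : ∀ a b s → ⟦ a ∧ b ∧ not s ⟧ + 1 * ⟦ a ∧ b ∧ s ⟧ ≡ ⟦ a ∧ b ⟧
⟦∧not⟧+⟦∧⟧ true  true  true  = refl
⟦∧not⟧+⟦∧⟧ true  true  false = refl
⟦∧not⟧+⟦∧⟧ true  false s     = refl
⟦∧not⟧+⟦∧⟧ false b     s     = refl

does-≟-sym : ∀ {n} (x y : Fin n) → does (x ≟ y) ≡ does (y ≟ x)
does-≟-sym x y with x ≟ y
... | yes x≡y = sym (dec-true (y ≟ x) (sym x≡y))
... | no x≢y  = sym (dec-false (y ≟ x) (x≢y ∘ sym))

sum-mono-≤ : ∀ {n} {f g : Fin n → ℕ} → (∀ i → f i ≤ g i) → sum f ≤ sum g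
sum-mono-≤ {zero}  f≤g = z≤n
sum-mono-≤ {suc n} f≤g = +-mono-≤ (f≤g Fin.zero) (sum-mono-≤ (f≤g ∘ Fin.suc))

∑∑-distrib-+ : ∀ {m n} (f g : Fin m → Fin n → ℕ) →
  ∑[ u < m ] ∑[ w < n ] (f u w + g u w) ≡ ∑[ u < m ] ∑[ w < n ] f u w + ∑[ u < m ] ∑[ w < n ] g u w
∑∑-distrib-+ {m} f g = trans (sum-cong-≗ (λ u → ∑-distrib-+ (f u) (g u))) (∑-distrib-+ {m} _ _)

δ : ∀ {n} → Fin n → Fin n → ℕ
δ v u = ⟦ does (u ≟ v) ⟧

∑-δ : ∀ {n} (v : Fin n) (f : Fin n → ℕ) → ∑[ u < n ] (δ v u * f u) ≡ f v
∑-δ {suc n} Fin.zero    f = trans (cong₂ _+_ (+-identityʳ (f Fin.zero)) (sum-replicate-zero n)) (+-identityʳ _)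
∑-δ {suc n} (Fin.suc v) f = ∑-δ v (f ∘ Fin.suc)

∑δ≡1 : ∀ {n} (v : Fin n) → ∑[ u < n ] δ v u ≡ 1
∑δ≡1 v = trans (sum-cong-≗ (λ u → sym (*-identityʳ (δ v u)))) (∑-δ v (const 1))

countB-++ : {A : Set} (p : A → Bool) (xs ys : List A) → countB p (xs ++ ys) ≡ countB p xs + countB p ys
countB-++ p []       ys = refl
countB-++ p (x ∷ xs) ys with p x
... | true  = cong suc (countB-++ p xs ys)
... | false = countB-++ p xs ys

countB-map : {A B : Set} (p : B → Bool) (g : A → B) (xs : List A) → countB p (map g xs) ≡ countB (p ∘ g) xs
countB-map p g []       = refl
countB-map p g (x ∷ xs) with p (g x)
... | true  = cong suc (countB-map p g xs)
... | false = countB-map p g xs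

countB-tabulate : {A : Set} {n : ℕ} (p : A → Bool) (f : Fin n → A) →
  countB p (tabulate f) ≡ ∑[ i < n ] ⟦ p (f i) ⟧
countB-tabulate {n = zero}  p f = refl
countB-tabulate {n = suc n} p f with p (f Fin.zero)
... | true  = cong suc (countB-tabulate p (f ∘ Fin.suc))
... | false = countB-tabulate p (f ∘ Fin.suc)

countB-allFin : {n : ℕ} (p : Fin n → Bool) → countB p (allFin n) ≡ ∑[ i < n ] ⟦ p i ⟧
countB-allFin p = countB-tabulate p id

countB-cartesianProduct-tabulate : {A B : Set} {m : ℕ} (p : A × B → Bool) (f : Fin m → A) (ys : List B) →
  countB p (cartesianProduct (tabulate f) ys) ≡ ∑[ i < m ] countB (λ y → p (f i , y)) ys
countB-cartesianProduct-tabulate {m = zero}  p f ys = refl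
countB-cartesianProduct-tabulate {m = suc m} p f ys = begin
  countB p (map (f Fin.zero ,_) ys ++ cartesianProduct (tabulate (f ∘ Fin.suc)) ys)
    ≡⟨ countB-++ p (map (f Fin.zero ,_) ys) _ ⟩
  countB p (map (f Fin.zero ,_) ys) + countB p (cartesianProduct (tabulate (f ∘ Fin.suc)) ys)
    ≡⟨ cong₂ _+_ (countB-map p (f Fin.zero ,_) ys) (countB-cartesianProduct-tabulate p (f ∘ Fin.suc) ys) ⟩
  countB (λ y → p (f Fin.zero , y)) ys + ∑[ i < m ] countB (λ y → p (f (Fin.suc i) , y)) ys ∎
  where open ≡-Reasoning

regroup : ∀ a b e → a + (b + e) + suc e ≡ a + (b + suc (e + e))
regroup = solve-∀

module _ (G : Graph) {c : ℕ} where

  properEdge? monochromaticEdge? : Coloring G c → Fin (n G) → Fin (n G) → Bool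
  properEdge?        χ u w = does (u <? w) ∧ adj G u w ∧ not (does (χ u ≟ χ w))
  monochromaticEdge? χ u w = does (u <? w) ∧ adj G u w ∧ does (χ u ≟ χ w)

  numProper≡∑ : (χ : Coloring G c) → numProper G χ ≡ ∑[ u < n G ] ∑[ w < n G ] ⟦ properEdge? χ u w ⟧
  numProper≡∑ χ = trans (countB-cartesianProduct-tabulate {m = n G} _ id (allFin (n G)))
                        (sum-cong-≗ (λ u → countB-allFin (properEdge? χ u)))

  nbrsWithColor≡∑ : ∀ (χ : Coloring G c) v a →
    nbrsWithColor G χ v a ≡ ∑[ w < n G ] ⟦ adj G v w ∧ does (χ w ≟ a) ⟧
  nbrsWithColor≡∑ χ v a = countB-allFin (λ w → adj G v w ∧ does (χ w ≟ a))

  dflip≡∑ : (χ ψ : Coloring G c) → dflip G χ ψ ≡ ∑[ w < n G ] ⟦ not (does (χ w ≟ ψ w)) ⟧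
  dflip≡∑ χ ψ = countB-allFin (λ w → not (does (χ w ≟ ψ w)))

  dflip-sym : (χ ψ : Coloring G c) → dflip G χ ψ ≡ dflip G ψ χ
  dflip-sym χ ψ = trans (dflip≡∑ χ ψ)
    (trans (sum-cong-≗ (λ w → cong (⟦_⟧ ∘ not) (does-≟-sym (χ w) (ψ w)))) (sym (dflip≡∑ ψ χ)))

  endpointsAt : Fin (n G) → Fin (n G) → Fin (n G) → ℕ
  endpointsAt v u w = δ v u + δ v w

  -- Recolouring v turns proper edges at v into monochromatic ones and back; counting the
  -- latter once per endpoint equal to v exactly compensates.
  proper+monochromatic-local : ∀ {χ ψ : Coloring G c} v → (∀ w → w ≢ v → χ w ≡ ψ w) → ∀ u w →
    ⟦ properEdge? χ u w ⟧ + endpointsAt v u w * ⟦ monochromaticEdge? χ u w ⟧ ≡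
    ⟦ properEdge? ψ u w ⟧ + endpointsAt v u w * ⟦ monochromaticEdge? ψ u w ⟧
  proper+monochromatic-local {χ} {ψ} v χ≗ψ u w with u ≟ v | w ≟ v
  ... | yes refl | yes refl rewrite dec-false (v <? v) (<-irrefl refl) = refl
  ... | yes refl | no _ = trans (⟦∧not⟧+⟦∧⟧ (does (v <? w)) (adj G v w) _)
                                (sym (⟦∧not⟧+⟦∧⟧ (does (v <? w)) (adj G v w) _))
  ... | no _ | yes refl = trans (⟦∧not⟧+⟦∧⟧ (does (u <? v)) (adj G u v) _)
                                (sym (⟦∧not⟧+⟦∧⟧ (does (u <? v)) (adj G u v) _))
  ... | no u≢v | no w≢v rewrite χ≗ψ u u≢v | χ≗ψ w w≢v = refl

  monochromatic-both-ways : ∀ χ v w →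
    ⟦ monochromaticEdge? χ v w ⟧ + ⟦ monochromaticEdge? χ w v ⟧ ≡ ⟦ adj G v w ∧ does (χ w ≟ χ v) ⟧
  monochromatic-both-ways χ v w with <-cmp v w
  ... | tri< v<w _ _ rewrite dec-true (v <? w) v<w | dec-false (w <? v) (<-asym v<w) | does-≟-sym (χ v) (χ w) =
    +-identityʳ _
  ... | tri> _ _ w<v rewrite dec-false (v <? w) (<-asym w<v) | dec-true (w <? v) w<v | Graph.sym G w v = refl
  ... | tri≈ _ refl _ rewrite irrefl G v | dec-false (v <? v) (<-irrefl refl) = refl

  ∑monochromaticAt≡nbrsWithColor : ∀ χ v →
    ∑[ u < n G ] ∑[ w < n G ] (endpointsAt v u w * ⟦ monochromaticEdge? χ u w ⟧) ≡ nbrsWithColor G χ v (χ v)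
  ∑monochromaticAt≡nbrsWithColor χ v = begin
    ∑[ u < n G ] ∑[ w < n G ] ((δ v u + δ v w) * M u w)
      ≡⟨ sum-cong-≗ (λ u → sum-cong-≗ (λ w → *-distribʳ-+ (M u w) (δ v u) (δ v w))) ⟩
    ∑[ u < n G ] ∑[ w < n G ] (δ v u * M u w + δ v w * M u w)
      ≡⟨ ∑∑-distrib-+ (λ u w → δ v u * M u w) (λ u w → δ v w * M u w) ⟩
    ∑[ u < n G ] ∑[ w < n G ] (δ v u * M u w) + ∑[ u < n G ] ∑[ w < n G ] (δ v w * M u w)
      ≡⟨ cong₂ _+_ (∑-comm (λ u w → δ v u * M u w)) (sum-cong-≗ (λ u → ∑-δ v (M u))) ⟩
    ∑[ w < n G ] ∑[ u < n G ] (δ v u * M u w) + ∑[ u < n G ] M u v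
      ≡⟨ cong (_+ ∑[ u < n G ] M u v) (sum-cong-≗ (λ w → ∑-δ v (λ u → M u w))) ⟩
    ∑[ w < n G ] M v w + ∑[ w < n G ] M w v
      ≡⟨ sym (∑-distrib-+ (M v) (λ w → M w v)) ⟩
    ∑[ w < n G ] (M v w + M w v)
      ≡⟨ sum-cong-≗ (monochromatic-both-ways χ v) ⟩
    ∑[ w < n G ] ⟦ adj G v w ∧ does (χ w ≟ χ v) ⟧
      ≡⟨ sym (nbrsWithColor≡∑ χ v (χ v)) ⟩
    nbrsWithColor G χ v (χ v) ∎
    where
    open ≡-Reasoning
    M : Fin (n G) → Fin (n G) → ℕ
    M u w = ⟦ monochromaticEdge? χ u w ⟧

  numProper+nbrsWithColor-local : ∀ {χ ψ : Coloring G c} v → (∀ w → w ≢ v → χ w ≡ ψ w) →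
    numProper G χ + nbrsWithColor G χ v (χ v) ≡ numProper G ψ + nbrsWithColor G ψ v (ψ v)
  numProper+nbrsWithColor-local {χ} {ψ} v χ≗ψ = begin
    numProper G χ + nbrsWithColor G χ v (χ v)
      ≡⟨ cong₂ _+_ (numProper≡∑ χ) (sym (∑monochromaticAt≡nbrsWithColor χ v)) ⟩
    ∑∑ (P χ) + ∑∑ (EM χ)
      ≡⟨ sym (∑∑-distrib-+ (P χ) (EM χ)) ⟩
    ∑[ u < n G ] ∑[ w < n G ] (P χ u w + EM χ u w)
      ≡⟨ sum-cong-≗ (λ u → sum-cong-≗ (proper+monochromatic-local v χ≗ψ u)) ⟩
    ∑[ u < n G ] ∑[ w < n G ] (P ψ u w + EM ψ u w)
      ≡⟨ ∑∑-distrib-+ (P ψ) (EM ψ) ⟩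
    ∑∑ (P ψ) + ∑∑ (EM ψ)
      ≡⟨ cong₂ _+_ (sym (numProper≡∑ ψ)) (∑monochromaticAt≡nbrsWithColor ψ v) ⟩
    numProper G ψ + nbrsWithColor G ψ v (ψ v) ∎
    where
    open ≡-Reasoning
    ∑∑ : (Fin (n G) → Fin (n G) → ℕ) → ℕ
    ∑∑ f = ∑[ u < n G ] ∑[ w < n G ] f u w
    P EM : Coloring G c → Fin (n G) → Fin (n G) → ℕ
    P  χ u w = ⟦ properEdge? χ u w ⟧
    EM χ u w = endpointsAt v u w * ⟦ monochromaticEdge? χ u w ⟧

  nbrsWithColor-≤-+dflip : ∀ (χ ψ : Coloring G c) v a →
    nbrsWithColor G χ v a ≤ nbrsWithColor G ψ v a + dflip G χ ψ
  nbrsWithColor-≤-+dflip χ ψ v a = begin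
    nbrsWithColor G χ v a                          ≡⟨ nbrsWithColor≡∑ χ v a ⟩
    ∑[ w < n G ] ⟦ adj G v w ∧ does (χ w ≟ a) ⟧   ≤⟨ sum-mono-≤ pointwise ⟩
    ∑[ w < n G ] (⟦ adj G v w ∧ does (ψ w ≟ a) ⟧ + ⟦ not (does (χ w ≟ ψ w)) ⟧)
      ≡⟨ ∑-distrib-+ (λ w → ⟦ adj G v w ∧ does (ψ w ≟ a) ⟧) _ ⟩
    ∑[ w < n G ] ⟦ adj G v w ∧ does (ψ w ≟ a) ⟧ + ∑[ w < n G ] ⟦ not (does (χ w ≟ ψ w)) ⟧
      ≡⟨ cong₂ _+_ (sym (nbrsWithColor≡∑ ψ v a)) (sym (dflip≡∑ χ ψ)) ⟩
    nbrsWithColor G ψ v a + dflip G χ ψ ∎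
    where
    open ≤-Reasoning
    pointwise : ∀ w → ⟦ adj G v w ∧ does (χ w ≟ a) ⟧ ≤ ⟦ adj G v w ∧ does (ψ w ≟ a) ⟧ + ⟦ not (does (χ w ≟ ψ w)) ⟧
    pointwise w with χ w ≟ ψ w
    ... | yes χw≡ψw rewrite χw≡ψw = m≤m+n _ 0
    ... | no _ = ≤-trans (⟦⟧≤1 (adj G v w ∧ does (χ w ≟ a))) (m≤n+m 1 _)

  blocked⇒≤ : ∀ {χ : Coloring G c} {v i} m → Blocked G χ v i (ℤ.+ suc m) →
    nbrsWithColor G χ v (χ v) + suc (m + m) ≤ nbrsWithColor G χ v i
  blocked⇒≤ {χ} {v} {i} m (ℤ.+≤+ le) = subst (λ x → nbrsWithColor G χ v (χ v) + x ≤ nbrsWithColor G χ v i) two-k-1 le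
    where
    two-k-1 : m + 1 * suc m ≡ suc (m + m)
    two-k-1 = trans (cong (m +_) (*-identityˡ (suc m))) (+-suc m m)

  revertAt : Coloring G c → Fin (n G) → Coloring G c → Coloring G c
  revertAt χ v χ' = updateAt χ' v (const (χ v))

  revertAt-≢ : ∀ (χ χ' : Coloring G c) {v w} → w ≢ v → revertAt χ v χ' w ≡ χ' w
  revertAt-≢ χ χ' {v} {w} w≢v = updateAt-minimal w v χ' w≢v

  dflip-revertAt : ∀ (χ χ' : Coloring G c) v → χ v ≢ χ' v → dflip G χ χ' ≡ suc (dflip G χ (revertAt χ v χ'))
  dflip-revertAt χ χ' v χv≢χ'v = begin
    dflip G χ χ'                                                    ≡⟨ dflip≡∑ χ χ' ⟩
    ∑[ w < n G ] ⟦ not (does (χ w ≟ χ' w)) ⟧                        ≡⟨ sum-cong-≗ pointwise ⟩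
    ∑[ w < n G ] (δ v w + ⟦ not (does (χ w ≟ χ̃ w)) ⟧)              ≡⟨ ∑-distrib-+ (δ v) _ ⟩
    ∑[ w < n G ] δ v w + ∑[ w < n G ] ⟦ not (does (χ w ≟ χ̃ w)) ⟧   ≡⟨ cong₂ _+_ (∑δ≡1 v) (sym (dflip≡∑ χ χ̃)) ⟩
    suc (dflip G χ χ̃) ∎
    where
    open ≡-Reasoning
    χ̃ = revertAt χ v χ'
    pointwise : ∀ w → ⟦ not (does (χ w ≟ χ' w)) ⟧ ≡ δ v w + ⟦ not (does (χ w ≟ χ̃ w)) ⟧
    pointwise w with w ≟ v
    ... | yes refl rewrite updateAt-updates v {const (χ v)} χ'
                         | dec-false (χ v ≟ χ' v) χv≢χ'v | dec-true (χ v ≟ χ v) refl = refl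
    ... | no w≢v rewrite revertAt-≢ χ χ' w≢v = refl

  revertAt-⊊ : ∀ (χ χ' : Coloring G c) v → χ v ≢ χ' v → DflipStrictSubset G χ (revertAt χ v χ') χ'
  revertAt-⊊ χ χ' v χv≢χ'v = shrinks , v , χv≢χ'v , λ χv≢χ̃v → χv≢χ̃v (sym (updateAt-updates v χ'))
    where
    shrinks : ∀ w → InDflip G χ (revertAt χ v χ') w → InDflip G χ χ' w
    shrinks w χw≢χ̃w with w ≟ v
    ... | yes refl = ⊥-elim (χw≢χ̃w (sym (updateAt-updates v χ')))
    ... | no w≢v   = subst (χ w ≢_) (revertAt-≢ χ χ' w≢v) χw≢χ̃w

  revertAt-isKNeighbor : ∀ (χ χ' : Coloring G c) {k} v → χ v ≢ χ' v →
    IsKNeighbor G k χ χ' → IsKNeighbor G k χ (revertAt χ v χ')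
  revertAt-isKNeighbor χ χ' v χv≢χ'v =
    ℤₚ.≤-trans (ℤ.+≤+ (subst (dflip G χ (revertAt χ v χ') ≤_) (sym (dflip-revertAt χ χ' v χv≢χ'v)) (m≤n+m _ 1)))

  revertAt-improving : ∀ (χ χ' : Coloring G c) {k} v → χ v ≢ χ' v → Blocked G χ v (χ' v) k →
    IsImprovingKNeighbor G k χ χ' → Improving G χ (revertAt χ v χ')
  revertAt-improving χ χ' {k} v χv≢χ'v blocked (d≤k , improving) = go k blocked d≤k
    where
    χ̃ = revertAt χ v χ'
    e = dflip G χ χ̃
    nₒ = nbrsWithColor G χ v (χ v)
    d≡suc-e : dflip G χ χ' ≡ suc e
    d≡suc-e = dflip-revertAt χ χ' v χv≢χ'v
    local : numProper G χ' + nbrsWithColor G χ' v (χ' v) ≡ numProper G χ̃ + nbrsWithColor G χ̃ v (χ v)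
    local = subst (λ a → numProper G χ' + nbrsWithColor G χ' v (χ' v) ≡ numProper G χ̃ + nbrsWithColor G χ̃ v a)
                  (updateAt-updates v χ')
                  (numProper+nbrsWithColor-local v (λ w w≢v → sym (revertAt-≢ χ χ' w≢v)))
    nᵢ-bound : nbrsWithColor G χ v (χ' v) ≤ nbrsWithColor G χ' v (χ' v) + suc e
    nᵢ-bound = subst (λ d → nbrsWithColor G χ v (χ' v) ≤ nbrsWithColor G χ' v (χ' v) + d) d≡suc-e
                     (nbrsWithColor-≤-+dflip χ χ' v (χ' v))
    ñ-bound : nbrsWithColor G χ̃ v (χ v) ≤ nₒ + e
    ñ-bound = subst (λ d → nbrsWithColor G χ̃ v (χ v) ≤ nₒ + d) (dflip-sym χ̃ χ)
                    (nbrsWithColor-≤-+dflip χ̃ χ v (χ v))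
    no-loss : ∀ m → Blocked G χ v (χ' v) (ℤ.+ suc m) → e ≤ m → numProper G χ' ≤ numProper G χ̃
    no-loss m blocked e≤m = +-cancelʳ-≤ (nₒ + suc (m + m)) (numProper G χ') (numProper G χ̃) (begin
      numProper G χ' + (nₒ + suc (m + m))                    ≤⟨ +-monoʳ-≤ (numProper G χ') (blocked⇒≤ {χ} m blocked) ⟩
      numProper G χ' + nbrsWithColor G χ v (χ' v)            ≤⟨ +-monoʳ-≤ (numProper G χ') nᵢ-bound ⟩
      numProper G χ' + (nbrsWithColor G χ' v (χ' v) + suc e) ≡⟨ sym (+-assoc (numProper G χ') _ (suc e)) ⟩
      numProper G χ' + nbrsWithColor G χ' v (χ' v) + suc e   ≡⟨ cong (_+ suc e) local ⟩
      numProper G χ̃ + nbrsWithColor G χ̃ v (χ v) + suc e     ≤⟨ +-monoˡ-≤ (suc e) (+-monoʳ-≤ (numProper G χ̃) ñ-bound) ⟩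
      numProper G χ̃ + (nₒ + e) + suc e                       ≡⟨ regroup (numProper G χ̃) nₒ e ⟩
      numProper G χ̃ + (nₒ + suc (e + e))                     ≤⟨ +-monoʳ-≤ (numProper G χ̃) (+-monoʳ-≤ nₒ (s≤s (+-mono-≤ e≤m e≤m))) ⟩
      numProper G χ̃ + (nₒ + suc (m + m))                     ∎)
      where open ≤-Reasoning
    go : ∀ k → Blocked G χ v (χ' v) k → IsKNeighbor G k χ χ' → Improving G χ χ̃
    go (ℤ.+ zero)  _       (ℤ.+≤+ d≤0) with () ← subst (_≤ 0) d≡suc-e d≤0
    go (ℤ.+ suc m) blocked (ℤ.+≤+ d≤k) =
      <-≤-trans improving (no-loss m blocked (≤-pred (subst (_≤ suc m) d≡suc-e d≤k)))
    go ℤ.-[1+ _ ]  _       ()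

lemma1 : (G : Graph) (c : ℕ) (χ : Coloring G c) (k : ℤ) (v : Fin (n G)) (i : Fin c) →
    ¬ (i ≡ χ v) → Blocked G χ v i k →
    (χ' : Coloring G c) → ¬ (IsMinimalImprovingKNeighbor G k χ χ' × χ' v ≡ i)
lemma1 G c χ k v i i≢χv blocked χ' (((d≤k , improving) , minimal) , χ'v≡i) =
  minimal (revertAt G χ v χ')
    ( ( revertAt-isKNeighbor G χ χ' v χv≢χ'v d≤k
      , revertAt-improving G χ χ' v χv≢χ'v blocked' (d≤k , improving))
    , revertAt-⊊ G χ χ' v χv≢χ'v)
  where
  χv≢χ'v : χ v ≢ χ' v
  χv≢χ'v χv≡χ'v = i≢χv (sym (trans χv≡χ'v χ'v≡i))
  blocked' : Blocked G χ v (χ' v) k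
  blocked' = subst (λ j → Blocked G χ v j k) (sym χ'v≡i) blocked
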